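{- (1) If $T_1,T_2$ are grounded trees, then $T_1\boxtimes T_2$ is a grounded tree: it is connected, has a single root vertex, that root has a loop, and every vertex has a directed path to the root. (2) If $T_1,T_2$ are grounded trees such that every vertex of $T_i$ has in-degree $w_i$ or $0$ ($i=1,2$), then every vertex of $T_1\boxtimes T_2$ has in-degree $w_1w_2$ or $0$. (3) For any widths $w_1,w_2>1$ and depth $\theta>0$, $T_{w_1}^\theta\boxtimes T_{w_2}^\theta\cong T_{w_1w_2}^\theta$. (4) For a grounded tree $T$ and $\alpha\ge1$, $C_\alpha\boxtimes T\cong C_\alpha(T)$. (5) For grounded trees $T_1,T_2$ and $\alpha\ge1$, $C_\alpha(T_1)\boxtimes T_2\cong C_\alpha(T_1\boxtimes T_2)$. (6) For grounded trees $T_1,T_2$ and $\alpha,\beta\ge1$, let $\gamma=\gcd(\alpha,\beta)$ and $\lambda=\mathrm{lcm}(\alpha,\beta)$. Then $C_\alpha(T_1)\boxtimes C_\beta(T_2)$ is isomorphic to the disjoint union of $\gamma$ copies of $C_\lambda(T_1\boxtimes T_2)$.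
   Context: For directed graphs $G_1,G_2$, the Kronecker product $G_1\boxtimes G_2$ has vertex set $V(G_1)\times V(G_2)$ and an edge $(v_1,v_2)\to(w_1,w_2)$ iff $v_1\to w_1$ in $G_1$ and $v_2\to w_2$ in $G_2$. In-degrees count loops. A grounded tree is a finite directed graph with a distinguished root $r$ having a loop $r\to r$, such that every other vertex has exactly one outgoing edge, the underlying undirected graph minus the loop is a tree, and every vertex has a directed path to $r$. For $w>1$, $\ell>0$, $T_w^\ell$ is the grounded tree with $w^\ell$ vertices in layers $0,\dots,\ell$: layer $0$ is the root (with loop); layer $1$ has $w-1$ vertices each with an edge to the root; for $1\le j<\ell$ each vertex in layer $j$ has exactly $w$ vertices of layer $j+1$ with edges to it; no other edges. $C_\alpha$ is the directed cycle with vertices $1,\dots,\alpha$ and edges $i\to i+1 \pmod\alpha$ (for $\alpha=1$, a single vertex with a loop). For a grounded tree $T$, the flower cycle $C_\alpha(T)$ is obtained from $\alpha$ disjoint copies $T_1,\dots,T_\alpha$ of $T$ by removing the loop at each root and adding an edge from the root of $T_i$ to the root of $T_{i+1}$, indices mod $\alpha$. -}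

module Defs where

open import Data.Bool using (Bool; true; false; _∧_; _∨_; not; T)
open import Data.Nat using (ℕ; zero; suc; _∸_)
import Data.Nat as ℕ
open import Data.Nat.DivMod using (_%_; m%n<n)
open import Data.Fin using (Fin; zero; suc; toℕ; fromℕ<)
import Data.Fin as F
open import Data.Vec using (Vec; []; _∷_)
open import Data.List using (List; []; _∷_; _++_)
open import Data.List.Relation.Unary.Unique.Propositional using (Unique)
open import Data.List.Relation.Unary.Linked using (Linked)
open import Data.Product using (Σ; _×_; _,_)
open import Data.Sum using (_⊎_)
open import Data.Empty using (⊥)
open import Data.Unit using (⊤; tt)
open import Function.Bundles using (_↔_; Inverse)
open import Relation.Nullary using (does; yes; no)
open import Relation.Binary.Definitions using (DecidableEquality)
open import Relation.Binary.PropositionalEquality using (_≡_; _≢_; refl; cong; cong₂)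
open import Relation.Binary.Construct.Closure.ReflexiveTransitive using (Star)
import Data.Product.Properties as ×P

record Graph : Set₁ where
  field
    V : Set
    E : V → V → Bool
open Graph public

Arc : (G : Graph) → V G → V G → Set
Arc G u v = T (E G u v)

Finite : Graph → Set
Finite G = Σ ℕ λ n → Fin n ↔ V G

_≅_ : Graph → Graph → Set
G ≅ H = Σ (V G ↔ V H) λ f →
  ∀ u v → E G u v ≡ E H (Inverse.to f u) (Inverse.to f v)

-- In-degree of v equals k: the set of in-neighbours u (u → v, loops
-- included) has exactly k elements.
InDegree : (G : Graph) → V G → ℕ → Set
InDegree G v k = (Σ (V G) λ u → Arc G u v) ↔ Fin k

_⊠_ : Graph → Graph → Graph
V (G ⊠ H) = V G × V H
E (G ⊠ H) (a , b) (c , d) = E G a c ∧ E H b d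

copies : ℕ → Graph → Graph
V (copies k G) = Fin k × V G
E (copies k G) (i , u) (j , v) = does (i F.≟ j) ∧ E G u v

-- Directed cycle C_α on Fin α (vertex i ↦ i+1 mod α; paper's vertices
-- 1..α correspond to 0..α-1).  For α = 0 this is the empty graph.

next : ∀ {n} → Fin n → Fin n
next {suc k} i = fromℕ< (m%n<n (suc (toℕ i)) (suc k))

Cycle : ℕ → Graph
V (Cycle α) = Fin α
E (Cycle α) i j = does (j F.≟ next i)

Und : (G : Graph) → V G → V G → Set
Und G u v = u ≢ v × (Arc G u v ⊎ Arc G v u)

Connected : Graph → Set
Connected G = ∀ u v → Star (Und G) u v

-- acyclic as an (undirected multi)graph: no 2-cycle formed by a pair of
-- antiparallel edges, and no simple cycle a b c ... a of length ≥ 3.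
Acyclic : Graph → Set
Acyclic G =
  (∀ u v → u ≢ v → Arc G u v → Arc G v u → ⊥) ×
  (∀ a b c (rest : List (V G)) → Unique (a ∷ b ∷ c ∷ rest) →
     Linked (Und G) (a ∷ b ∷ c ∷ rest ++ a ∷ []) → ⊥)

record IsGroundedTree (G : Graph) (r : V G) : Set where
  field
    finite     : Finite G
    rootLoop   : Arc G r r
    outOne     : ∀ v → v ≢ r →
                 Σ (V G) λ w → Arc G v w × (∀ w′ → Arc G v w′ → w′ ≡ w)
    connected  : Connected G
    acyclic    : Acyclic G
    reachRoot  : ∀ v → Star (Arc G) v r

record GroundedTree : Set₁ where
  field
    graph  : Graph
    root   : V graph
    decEq  : DecidableEquality (V graph)
    isGT   : IsGroundedTree graph root
open GroundedTree public

-- Flower cycle C_α(T) of a rooted graph (needs decidable equality to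
-- recognise the root).

flower : ℕ → (G : Graph) → V G → DecidableEquality (V G) → Graph
V (flower α G r _≟_) = Fin α × V G
E (flower α G r _≟_) (i , u) (j , v) =
  (does (i F.≟ j) ∧ E G u v ∧ not (does (u ≟ r) ∧ does (v ≟ r)))
  ∨ (does (u ≟ r) ∧ does (v ≟ r) ∧ does (j F.≟ next i))

C[_]_ : ℕ → GroundedTree → Graph
C[ α ] T = flower α (graph T) (root T) (decEq T)

prodRoot : (T₁ T₂ : GroundedTree) → V (graph T₁ ⊠ graph T₂)
prodRoot T₁ T₂ = root T₁ , root T₂

prodDec : (T₁ T₂ : GroundedTree) → DecidableEquality (V (graph T₁ ⊠ graph T₂))
prodDec T₁ T₂ = ×P.≡-dec (decEq T₁) (decEq T₂)

-- Node w j = vertices of layer j: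
--   layer 0: the root; layer 1: w-1 vertices (top a, a : Fin (w ∸ 1));
--   layer j+2: child x n, x : Fin w, a w-fold child of n in layer j+1.

data Node (w : ℕ) : ℕ → Set where
  root′ : Node w 0
  top   : Fin (w ∸ 1) → Node w 1
  child : ∀ {j} → Fin w → Node w (suc j) → Node w (suc (suc j))

parent : ∀ {w j} → Node w (suc j) → Node w j
parent (top a)     = root′
parent (child x n) = n

nodeEq : ∀ {w j} → (x y : Node w j) → Bool
nodeEq root′ root′ = true
nodeEq (top a) (top b) = does (a F.≟ b)
nodeEq (child x n) (child y m) = does (x F.≟ y) ∧ nodeEq n m

tEdge : ∀ {w} m → Node w m → ∀ n → Node w n → Bool
tEdge zero    x zero    y = true          -- loop at the root
tEdge zero    x (suc n) y = false
tEdge (suc m) x n y with m ℕ.≟ n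
... | yes refl = nodeEq (parent x) y      -- edge to the parent
... | no _     = false

Tree : ℕ → ℕ → Graph
V (Tree w ℓ) = Σ (Fin (suc ℓ)) λ j → Node w (toℕ j)
E (Tree w ℓ) (j , x) (k , y) = tEdge (toℕ j) x (toℕ k) y

-- A grounded tree is the graph of its parent map, which fixes the root and
-- brings every vertex to the root in finitely many steps; conversely, on a
-- finite vertex set such a map defines a grounded tree, acyclicity following
-- from the depth function: a non-backtracking walk may first approach the
-- root and then leave it, but never the other way round.  Products, cycles and
-- flowers are graphs of maps as well, so every isomorphism reduces to a
-- bijection intertwining two maps.  C_α ⊠ T and C_α(T) are intertwined by
-- (i , u) ↦ (i + depth u , u); (5) and (6) follow by reassociating products,
-- together with C_α ⊠ C_β ≅ gcd(α,β) · C_lcm(α,β), witnessed by the injection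
-- (c , k) ↦ (c + k mod α , k mod β) between sets of equal size.  For (3) a
-- vertex of T_w^θ is the digit string of its path from the root, the parent
-- map becomes a shift of digit strings, and a product of shifts is the shift
-- on pairs of digits.

module Submission where

open import Defs
open import Data.Bool using (true; false; T; _∧_)
open import Data.Bool.Properties using (T-∧; T-irrelevant; ∧-identityʳ; ∧-zeroʳ; ∨-identityʳ)
open import Data.Empty using (⊥; ⊥-elim)
import Data.Nat as ℕ
open import Data.Nat using (ℕ; zero; suc; _+_; _*_; _∸_; _<_; _≤_; NonZero; ≢-nonZero)
open import Data.Nat.GCD using (gcd; gcd[m,n]∣m; gcd[m,n]∣n; gcd[m,n]≢0)
open import Data.Nat.LCM using (lcm; m∣lcm[m,n]; n∣lcm[m,n]; lcm-least; gcd*lcm)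
import Data.Nat.Properties as ℕP
open import Data.Nat.Properties using (m*n≢0; m*n≢0⇒n≢0)
open import Data.Nat.DivMod using (_%_; _/_; m%n<n; m<n⇒m%n≡m; [m+n]%n≡m%n; m≡m%n+[m/n]*n; m%n%n≡m%n; %-remove-+ʳ; m∣n⇒o%n%m≡o%m; %-distribˡ-+)
open import Data.Nat.Divisibility using (_∣_; divides; ∣-trans; ∣⇒≤; >⇒∤)
open import Data.Nat.GeneralisedArithmetic using (iterate)
open import Data.Fin using (Fin; zero; suc; toℕ; inject≤)
import Data.Fin as F
import Data.Fin.Properties as FinP
open import Data.Product using (Σ; ∃; ∃-syntax; _×_; _,_; proj₁; proj₂; map; map₂)
open import Data.Product.Properties using (×-≡,≡↔≡; ≡-dec)
open import Data.Product.Function.NonDependent.Propositional using (_×-⇔_; _×-↔_)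
open import Data.Sum using (_⊎_; inj₁; inj₂; [_,_]′; swap)
open import Data.List using (List; []; _∷_; _++_)
open import Data.Vec using (Vec; []; _∷_; _∷ʳ_; replicate)
import Data.Vec as Vec
open import Data.Vec.Properties using (×v↔v×; map-∷ʳ; map-∘; map-cong; map-id)
open import Data.List.Relation.Unary.All using (All; []; _∷_)
open import Data.List.Relation.Unary.All.Properties using (All¬⇒¬Any)
open import Data.List.Relation.Unary.AllPairs using ([]; _∷_)
import Data.List.Relation.Unary.AllPairs as AllPairs
open import Data.List.Relation.Unary.Linked.Properties using (Linked⇒AllPairs)
open import Data.List.Relation.Unary.Any using (Any; here; there)
import Data.List.Relation.Unary.Any as Any
open import Data.List.Relation.Unary.Linked using (Linked; []; [-]; _∷_)
import Data.List.Relation.Unary.Linked as Linked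
open import Data.List.Relation.Unary.Unique.Propositional using (Unique)
open import Data.Unit using (⊤; tt)
open import Function using (_∘_; id)
open import Function.Bundles using (_↔_; _⇔_; Inverse; Equivalence; Injection; mk↔ₛ′; mk⇔)
open import Function.Properties.Equivalence using () renaming (trans to ⇔-trans; sym to ⇔-sym)
open import Function.Properties.Inverse using (↔⇒⇔; ↔⇒↣; ↔-sym; ↔-trans)
open import Relation.Nullary using (Dec; yes; no; does)
open import Relation.Binary.Definitions using (DecidableEquality; Transitive)
open import Function.Definitions using (Injective)
open import Relation.Binary.PropositionalEquality
open import Relation.Binary.Construct.Closure.ReflexiveTransitive using (Star; ε; _◅_; _◅◅_)
import Relation.Binary.Construct.Closure.ReflexiveTransitive as Star

private
  variable
    A B C D : Set

T-injective : ∀ {a b} → T a ⇔ T b → a ≡ b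
T-injective {false} {false} _ = refl
T-injective {false} {true}  e = ⊥-elim (Equivalence.from e tt)
T-injective {true}  {false} e = ⊥-elim (Equivalence.to e tt)
T-injective {true}  {true}  _ = refl

T-does : ∀ {P : Set} (P? : Dec P) → T (does P?) ⇔ P
T-does (yes p) = mk⇔ (λ _ → p) (λ _ → tt)
T-does (no ¬p) = mk⇔ (λ ()) ¬p

-- Functional graphs and conjugacy

IsGraphOf : (G : Graph) → (V G → V G) → Set
IsGraphOf G f = ∀ u v → Arc G u v ⇔ v ≡ f u

graphOf-⊠ : ∀ {G H f g} → IsGraphOf G f → IsGraphOf H g → IsGraphOf (G ⊠ H) (map f g)
graphOf-⊠ Gf Hg (a , b) (c , d) = ⇔-trans T-∧ (⇔-trans (Gf a c ×-⇔ Hg b d) (↔⇒⇔ ×-≡,≡↔≡))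

graphOf-copies : ∀ {G f} n → IsGraphOf G f → IsGraphOf (copies n G) (map₂ f)
graphOf-copies n Gf (i , u) (j , v) =
  ⇔-trans T-∧ (⇔-trans (⇔-trans (T-does (i F.≟ j)) (mk⇔ sym sym) ×-⇔ Gf u v) (↔⇒⇔ ×-≡,≡↔≡))

graphOf-Cycle : ∀ n → IsGraphOf (Cycle n) next
graphOf-Cycle n i j = T-does (j F.≟ next i)

record Conjugacy (f : A → A) (g : B → B) : Set where
  field
    bijection : A ↔ B
  open Inverse bijection public
  field
    commutes : ∀ x → to (f x) ≡ g (to x)

  to-injective : ∀ {x y} → to x ≡ to y → x ≡ y
  to-injective = Injection.injective (↔⇒↣ bijection)

graphOf-≅ : ∀ {G H f g} → IsGraphOf G f → IsGraphOf H g → Conjugacy f g → G ≅ H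
graphOf-≅ {G} {H} {f} {g} Gf Hg φ = bijection , λ u v → T-injective (arc⇔arc u v)
  where
  open Conjugacy φ
  arc⇔arc : ∀ u v → Arc G u v ⇔ Arc H (to u) (to v)
  arc⇔arc u v = ⇔-trans (Gf u v) (⇔-trans to-≡ (⇔-sym (Hg (to u) (to v))))
    where
    to-≡ : v ≡ f u ⇔ to v ≡ g (to u)
    to-≡ = mk⇔ (λ { refl → commutes u }) (λ e → to-injective (trans e (sym (commutes u))))

module _ {f : A → A} {g : B → B} where

  conj-sym : Conjugacy f g → Conjugacy g f
  conj-sym φ = record { bijection = ↔-sym bijection ; commutes = commutes′ }
    where
    open Conjugacy φ
    commutes′ : ∀ y → from (g y) ≡ f (from y)
    commutes′ y = to-injective (begin
      to (from (g y))     ≡⟨ strictlyInverseˡ (g y) ⟩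
      g y                 ≡⟨ cong g (strictlyInverseˡ y) ⟨
      g (to (from y))     ≡⟨ commutes (from y) ⟨
      to (f (from y))     ∎)
      where open ≡-Reasoning

  conj-trans : ∀ {h : C → C} → Conjugacy f g → Conjugacy g h → Conjugacy f h
  conj-trans φ ψ = record
    { bijection = ↔-trans (Conjugacy.bijection φ) (Conjugacy.bijection ψ)
    ; commutes  = λ x → trans (cong (Conjugacy.to ψ) (Conjugacy.commutes φ x)) (Conjugacy.commutes ψ _)
    }

conj-refl : ∀ (f : A → A) → Conjugacy f f
conj-refl f = record { bijection = mk↔ₛ′ id id (λ _ → refl) (λ _ → refl) ; commutes = λ _ → refl }

conj-× : ∀ {f : A → A} {g : B → B} {f′ : C → C} {g′ : D → D} →
         Conjugacy f g → Conjugacy f′ g′ → Conjugacy (map f f′) (map g g′)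
conj-× φ ψ = record
  { bijection = Conjugacy.bijection φ ×-↔ Conjugacy.bijection ψ
  ; commutes  = λ (x , y) → cong₂ _,_ (Conjugacy.commutes φ x) (Conjugacy.commutes ψ y)
  }

conj-assoc : ∀ (f : A → A) (g : B → B) (h : C → C) →
             Conjugacy (map (map f g) h) (map f (map g h))
conj-assoc f g h = record
  { bijection = mk↔ₛ′ (λ ((a , b) , c) → a , (b , c)) (λ (a , (b , c)) → (a , b) , c)
                      (λ _ → refl) (λ _ → refl)
  ; commutes  = λ _ → refl
  }

conj-interchange : ∀ (f : A → A) (g : B → B) (h : C → C) (k : D → D) →
                   Conjugacy (map (map f g) (map h k)) (map (map f h) (map g k))
conj-interchange f g h k = record
  { bijection = mk↔ₛ′ (λ ((a , b) , (c , d)) → (a , c) , (b , d))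
                      (λ ((a , c) , (b , d)) → (a , b) , (c , d))
                      (λ _ → refl) (λ _ → refl)
  ; commutes  = λ _ → refl
  }

-- Iteration and rotation

iterate-+ : ∀ (f : A → A) x m n → iterate f x (m + n) ≡ iterate f (iterate f x m) n
iterate-+ f x zero    n = refl
iterate-+ f x (suc m) n = iterate-+ f (f x) m n

iterate-fixed : ∀ (f : A → A) {r} → f r ≡ r → ∀ n → iterate f r n ≡ r
iterate-fixed f fr zero    = refl
iterate-fixed f fr (suc n) = trans (cong (λ x → iterate f x n) fr) (iterate-fixed f fr n)

iterate-stays : ∀ (f : A → A) {r} → f r ≡ r → ∀ v k → iterate f v k ≡ r → ∀ j → iterate f v (k + j) ≡ r
iterate-stays f fr v k reach j =
  trans (iterate-+ f v k j) (trans (cong (λ x → iterate f x j) reach) (iterate-fixed f fr j))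

iterate-commutes : ∀ (f : A → A) x n → iterate f (f x) n ≡ f (iterate f x n)
iterate-commutes f x zero    = refl
iterate-commutes f x (suc n) = iterate-commutes f (f x) n

iterate-inverse : ∀ (f g : A → A) → (∀ x → f (g x) ≡ x) → ∀ x n → iterate f (iterate g x n) n ≡ x
iterate-inverse f g fg x zero    = refl
iterate-inverse f g fg x (suc n) = begin
  iterate f (iterate g (g x) n) (suc n)  ≡⟨ iterate-commutes f _ n ⟩
  f (iterate f (iterate g (g x) n) n)    ≡⟨ cong f (iterate-inverse f g fg (g x) n) ⟩
  f (g x)                                ≡⟨ fg x ⟩
  x                                      ∎
  where open ≡-Reasoning

iterate-map : ∀ (f : A → A) (g : B → B) x y n → iterate (map f g) (x , y) n ≡ (iterate f x n , iterate g y n)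
iterate-map f g x y zero    = refl
iterate-map f g x y (suc n) = iterate-map f g (f x) (g y) n

[m%n+k]%n≡[m+k]%n : ∀ m k n .{{_ : NonZero n}} → (m % n + k) % n ≡ (m + k) % n
[m%n+k]%n≡[m+k]%n m k n = begin
  (m % n + k) % n          ≡⟨ %-distribˡ-+ (m % n) k n ⟩
  (m % n % n + k % n) % n  ≡⟨ cong (λ x → (x + k % n) % n) (m%n%n≡m%n m n) ⟩
  (m % n + k % n) % n      ≡⟨ %-distribˡ-+ m k n ⟨
  (m + k) % n              ∎
  where open ≡-Reasoning

toℕ-next : ∀ {n} .{{_ : NonZero n}} (i : Fin n) → toℕ (next i) ≡ suc (toℕ i) % n
toℕ-next {suc k} i = FinP.toℕ-fromℕ< (m%n<n (suc (toℕ i)) (suc k))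

toℕ-iterate-next : ∀ {n} .{{_ : NonZero n}} (i : Fin n) k → toℕ (iterate next i k) ≡ (toℕ i + k) % n
toℕ-iterate-next {n} i zero = begin
  toℕ i            ≡⟨ m<n⇒m%n≡m (FinP.toℕ<n i) ⟨
  toℕ i % n        ≡⟨ cong (_% n) (ℕP.+-identityʳ (toℕ i)) ⟨
  (toℕ i + 0) % n  ∎
  where open ≡-Reasoning
toℕ-iterate-next {n} i (suc k) = begin
  toℕ (iterate next (next i) k)  ≡⟨ toℕ-iterate-next (next i) k ⟩
  (toℕ (next i) + k) % n         ≡⟨ cong (λ x → (x + k) % n) (toℕ-next i) ⟩
  (suc (toℕ i) % n + k) % n      ≡⟨ [m%n+k]%n≡[m+k]%n (suc (toℕ i)) k n ⟩
  (suc (toℕ i) + k) % n          ≡⟨ cong (_% n) (ℕP.+-suc (toℕ i) k) ⟨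
  (toℕ i + suc k) % n            ∎
  where open ≡-Reasoning

next-period : ∀ {n} (i : Fin n) → iterate next i n ≡ i
next-period {suc k} i = FinP.toℕ-injective (begin
  toℕ (iterate next i (suc k))  ≡⟨ toℕ-iterate-next i (suc k) ⟩
  (toℕ i + suc k) % suc k       ≡⟨ [m+n]%n≡m%n (toℕ i) (suc k) ⟩
  toℕ i % suc k                 ≡⟨ m<n⇒m%n≡m (FinP.toℕ<n i) ⟩
  toℕ i                         ∎)
  where open ≡-Reasoning

prev : ∀ {n} → Fin n → Fin n
prev {suc k} i = iterate next i k

prev-next : ∀ {n} (i : Fin n) → prev (next i) ≡ i
prev-next {suc k} i = next-period i

next-prev : ∀ {n} (i : Fin n) → next (prev i) ≡ i
next-prev {suc k} i = trans (sym (iterate-commutes next i k)) (next-period i)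

rotate : ∀ {n} → ℕ → Fin n ↔ Fin n
rotate k = mk↔ₛ′ (λ i → iterate next i k) (λ i → iterate prev i k)
                 (λ i → iterate-inverse next prev next-prev i k)
                 (λ i → iterate-inverse prev next prev-next i k)

twist : (B → A ↔ A) → (A × B) ↔ (A × B)
twist σ = mk↔ₛ′ (λ (a , b) → Inverse.to (σ b) a , b) (λ (a , b) → Inverse.from (σ b) a , b)
                (λ (a , b) → cong (_, b) (Inverse.strictlyInverseˡ (σ b) a))
                (λ (a , b) → cong (_, b) (Inverse.strictlyInverseʳ (σ b) a))

iterate-next-cong : ∀ {n} .{{_ : NonZero n}} (x : Fin n) {m m′} → m % n ≡ m′ % n →
                    iterate next x m ≡ iterate next x m′
iterate-next-cong {n} x {m} {m′} eq = FinP.toℕ-injective (begin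
  toℕ (iterate next x m)       ≡⟨ toℕ-iterate-next x m ⟩
  (toℕ x + m) % n              ≡⟨ %-distribˡ-+ (toℕ x) m n ⟩
  (toℕ x % n + m % n) % n      ≡⟨ cong (λ y → (toℕ x % n + y) % n) eq ⟩
  (toℕ x % n + m′ % n) % n     ≡⟨ %-distribˡ-+ (toℕ x) m′ n ⟨
  (toℕ x + m′) % n             ≡⟨ toℕ-iterate-next x m′ ⟨
  toℕ (iterate next x m′)      ∎)
  where open ≡-Reasoning

iterate-next-∣ : ∀ {n l} .{{_ : NonZero n}} .{{_ : NonZero l}} → n ∣ l → (x : Fin n) (k : Fin l) →
                 iterate next x (toℕ (next k)) ≡ next (iterate next x (toℕ k))
iterate-next-∣ {n} {l} n∣l x k = begin
  iterate next x (toℕ (next k))  ≡⟨ iterate-next-cong x (begin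
      toℕ (next k) % n              ≡⟨ cong (_% n) (toℕ-next k) ⟩
      suc (toℕ k) % l % n           ≡⟨ m∣n⇒o%n%m≡o%m n l (suc (toℕ k)) n∣l ⟩
      suc (toℕ k) % n               ∎) ⟩
  iterate next x (suc (toℕ k))   ≡⟨ iterate-commutes next x (toℕ k) ⟩
  next (iterate next x (toℕ k))  ∎
  where open ≡-Reasoning

iterate-next-cancel : ∀ {n} (x y : Fin n) m j → iterate next x (m + j) ≡ iterate next y j →
                      iterate next x m ≡ y
iterate-next-cancel x y m j eq =
  Injection.injective (↔⇒↣ (rotate j)) (trans (sym (iterate-+ next x m j)) eq)

-- Grounded functional graphs

record Grounding (G : Graph) (r : V G) : Set where
  field
    succ        : V G → V G
    isGraphOf   : IsGraphOf G succ
    succ-root   : succ r ≡ r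
    reachesRoot : ∀ v → ∃[ k ] iterate succ v k ≡ r

module Depth {A : Set} (_≟_ : DecidableEquality A) (f : A → A) (r : A)
             (reaches : ∀ v → ∃[ k ] iterate f v k ≡ r) where

  depthWithin : ℕ → A → ℕ
  depthWithin zero    v = 0
  depthWithin (suc k) v with v ≟ r
  ... | yes _ = 0
  ... | no  _ = suc (depthWithin k (f v))

  depthWithin-cong : ∀ k k′ v → iterate f v k ≡ r → iterate f v k′ ≡ r →
                     depthWithin k v ≡ depthWithin k′ v
  depthWithin-cong zero    zero     v _ _ = refl
  depthWithin-cong zero    (suc k′) v v≡r _ with v ≟ r
  ... | yes _   = refl
  ... | no v≢r = ⊥-elim (v≢r v≡r)
  depthWithin-cong (suc k) zero     v _ v≡r with v ≟ r
  ... | yes _   = refl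
  ... | no v≢r = ⊥-elim (v≢r v≡r)
  depthWithin-cong (suc k) (suc k′) v e e′ with v ≟ r
  ... | yes _ = refl
  ... | no _  = cong suc (depthWithin-cong k k′ (f v) e e′)

  depth : A → ℕ
  depth v = depthWithin (proj₁ (reaches v)) v

  depth-root : depth r ≡ 0
  depth-root with proj₁ (reaches r)
  ... | zero  = refl
  ... | suc _ with r ≟ r
  ...   | yes _  = refl
  ...   | no r≢r = ⊥-elim (r≢r refl)

  depth-step : ∀ {v} → v ≢ r → depth v ≡ suc (depth (f v))
  depth-step {v} v≢r with reaches v
  ... | zero  , v≡r = ⊥-elim (v≢r v≡r)
  ... | suc k , e with v ≟ r
  ...   | yes v≡r = ⊥-elim (v≢r v≡r)
  ...   | no _    = cong suc (depthWithin-cong k (proj₁ (reaches (f v))) (f v) e (proj₂ (reaches (f v))))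

  depth≡0⇒root : ∀ {v} → depth v ≡ 0 → v ≡ r
  depth≡0⇒root {v} d≡0 with v ≟ r
  ... | yes v≡r = v≡r
  ... | no v≢r with () ← trans (sym d≡0) (depth-step v≢r)

NoBacktrack : List A → Set
NoBacktrack (x ∷ y ∷ z ∷ l) = x ≢ z × NoBacktrack (y ∷ z ∷ l)
NoBacktrack _               = ⊤

LastStep : (A → A → Set) → List A → Set
LastStep R (x ∷ y ∷ [])    = R x y
LastStep R (x ∷ y ∷ z ∷ l) = LastStep R (y ∷ z ∷ l)
LastStep R _               = ⊥

noBacktrack-∷ʳ : ∀ {a x y : A} l → Unique (x ∷ y ∷ l) → All (a ≢_) (x ∷ y ∷ l) →
                 NoBacktrack (x ∷ y ∷ l ++ a ∷ [])
noBacktrack-∷ʳ []      _                    (a≢x ∷ _) = (λ x≡a → a≢x (sym x≡a)) , tt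
noBacktrack-∷ʳ (z ∷ l) ((_ ∷ x≢z ∷ _) ∷ u) (_ ∷ a∉) = x≢z , noBacktrack-∷ʳ l u a∉

lastStep-∈ : ∀ {R : A → A → Set} x w l {y} → LastStep R (x ∷ w ∷ l ++ y ∷ []) →
             Any (λ z → R z y) (w ∷ l)
lastStep-∈ x w []      s = here s
lastStep-∈ x w (v ∷ l) s = there (lastStep-∈ w v l s)

linked-ends : ∀ {R : A → A → Set} → Transitive R → ∀ {x y} l → Linked R (x ∷ l ++ y ∷ []) → R x y
linked-ends trans []      (Rxy ∷ [-])   = Rxy
linked-ends trans (w ∷ l) (Rxw ∷ Rrest) = trans Rxw (linked-ends trans l Rrest)

und-sym : ∀ {G u v} → Und G u v → Und G v u
und-sym (u≢v , arc) = u≢v ∘ sym , swap arc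

arcs⇒walk : ∀ {G} → DecidableEquality (V G) → ∀ {u v} → Star (Arc G) u v → Star (Und G) u v
arcs⇒walk _≟_ ε = ε
arcs⇒walk _≟_ (_◅_ {i = u} {j = w} arc path) with u ≟ w
... | yes refl = arcs⇒walk _≟_ path
... | no u≢w   = (u≢w , inj₁ arc) ◅ arcs⇒walk _≟_ path

module FromGrounding {G : Graph} {r : V G} (_≟_ : DecidableEquality (V G)) (𝒢 : Grounding G r) where

  open Grounding 𝒢
  open Depth _≟_ succ r reachesRoot

  arc-succ : ∀ u → Arc G u (succ u)
  arc-succ u = Equivalence.from (isGraphOf u (succ u)) refl

  arc⇒succ : ∀ {u v} → Arc G u v → v ≡ succ u
  arc⇒succ {u} {v} = Equivalence.to (isGraphOf u v)

  _⇝_ : V G → V G → Set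
  u ⇝ v = u ≢ v × v ≡ succ u

  depth-⇝ : ∀ {u v} → u ⇝ v → depth v < depth u
  depth-⇝ (u≢v , refl) = ℕP.≤-reflexive (sym (depth-step λ { refl → u≢v (sym succ-root) }))

  und⇒⇝ : ∀ {u v} → Und G u v → u ⇝ v ⊎ v ⇝ u
  und⇒⇝ (u≢v , inj₁ arc) = inj₁ (u≢v , arc⇒succ arc)
  und⇒⇝ (u≢v , inj₂ arc) = inj₂ (u≢v ∘ sym , arc⇒succ arc)

  firstStep : ∀ {x y} l → Linked (Und G) (x ∷ y ∷ l) → NoBacktrack (x ∷ y ∷ l) →
              x ⇝ y ⊎ Linked (λ u v → v ⇝ u) (x ∷ y ∷ l)
  firstStep l (xy ∷ walk) nb with und⇒⇝ xy
  ... | inj₁ x⇝y = inj₁ x⇝y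
  firstStep []      (_ ∷ _)    _          | inj₂ y⇝x = inj₂ (y⇝x ∷ [-])
  firstStep (z ∷ l) (_ ∷ walk) (x≢z , nb) | inj₂ y⇝x with firstStep l walk nb
  ... | inj₁ y⇝z = ⊥-elim (x≢z (trans (proj₂ y⇝x) (sym (proj₂ y⇝z))))
  ... | inj₂ away = inj₂ (y⇝x ∷ away)

  lastStep : ∀ {x y} l → Linked (Und G) (x ∷ y ∷ l) → NoBacktrack (x ∷ y ∷ l) →
             Linked _⇝_ (x ∷ y ∷ l) ⊎ LastStep (λ u v → v ⇝ u) (x ∷ y ∷ l)
  lastStep [] (xy ∷ [-]) _ with und⇒⇝ xy
  ... | inj₁ x⇝y = inj₁ (x⇝y ∷ [-])
  ... | inj₂ y⇝x = inj₂ y⇝x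
  lastStep (z ∷ l) (xy ∷ walk) (x≢z , nb) with lastStep l walk nb
  ... | inj₂ last = inj₂ last
  ... | inj₁ towards@(y⇝z ∷ _) with und⇒⇝ xy
  ...   | inj₁ x⇝y = inj₁ (x⇝y ∷ towards)
  ...   | inj₂ y⇝x = ⊥-elim (x≢z (trans (proj₂ y⇝x) (sym (proj₂ y⇝z))))

  -- On a non-backtracking walk a step away from the root is only followed by such
  -- steps.  A closed walk cannot move monotonically in depth, so it starts with
  -- a ⇝ b and ends with a step z — a where a ⇝ z; then b = succ a = z is repeated.
  noClosedWalk : ∀ a b c rest → Unique (a ∷ b ∷ c ∷ rest) →
                 Linked (Und G) (a ∷ b ∷ c ∷ rest ++ a ∷ []) → ⊥
  noClosedWalk a b c rest (a∉@(_ ∷ a≢c ∷ _) ∷ u@(b∉ ∷ _)) walk =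
    [ (λ a⇝b → [ towardsRoot , lastStepBack a⇝b ]′ (lastStep (c ∷ rest ++ a ∷ []) walk nb))
    , awayFromRoot
    ]′ (firstStep (c ∷ rest ++ a ∷ []) walk nb)
    where
    nb : NoBacktrack (a ∷ b ∷ c ∷ rest ++ a ∷ [])
    nb = a≢c , noBacktrack-∷ʳ rest u a∉

    awayFromRoot : Linked (λ u v → v ⇝ u) (a ∷ b ∷ c ∷ rest ++ a ∷ []) → ⊥
    awayFromRoot away = ℕP.<-irrefl refl (linked-ends ℕP.<-trans (b ∷ c ∷ rest)
      (Linked.map depth-⇝ away))

    towardsRoot : Linked _⇝_ (a ∷ b ∷ c ∷ rest ++ a ∷ []) → ⊥
    towardsRoot towards = ℕP.<-irrefl refl (linked-ends (λ p q → ℕP.<-trans q p) (b ∷ c ∷ rest)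
      (Linked.map depth-⇝ towards))

    lastStepBack : a ⇝ b → LastStep (λ u v → v ⇝ u) (a ∷ b ∷ c ∷ rest ++ a ∷ []) → ⊥
    lastStepBack a⇝b last = All¬⇒¬Any b∉
      (Any.map (λ a⇝z → trans (proj₂ a⇝b) (sym (proj₂ a⇝z))) (lastStep-∈ b c rest last))

  pathToRoot : ∀ v k → iterate succ v k ≡ r → Star (Arc G) v r
  pathToRoot v zero    refl  = ε
  pathToRoot v (suc k) reach = arc-succ v ◅ pathToRoot (succ v) k reach

  isGroundedTree : Finite G → IsGroundedTree G r
  isGroundedTree fin = record
    { finite    = fin
    ; rootLoop  = subst (Arc G r) succ-root (arc-succ r)
    ; outOne    = λ v _ → succ v , arc-succ v , λ _ → arc⇒succ
    ; connected = λ u v → arcs⇒walk _≟_ (toRoot u) ◅◅ Star.reverse (und-sym {G}) (arcs⇒walk _≟_ (toRoot v))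
    ; acyclic   = antiparallel , noClosedWalk
    ; reachRoot = toRoot
    }
    where
    toRoot : ∀ v → Star (Arc G) v r
    toRoot v = pathToRoot v (proj₁ (reachesRoot v)) (proj₂ (reachesRoot v))

    antiparallel : ∀ u v → u ≢ v → Arc G u v → Arc G v u → ⊥
    antiparallel u v u≢v uv vu =
      ℕP.<-asym (depth-⇝ (u≢v , arc⇒succ uv)) (depth-⇝ (u≢v ∘ sym , arc⇒succ vu))

module FromGroundedTree (T : GroundedTree) where

  open GroundedTree T renaming (graph to G; root to r; decEq to _≟_)
  open IsGroundedTree (GroundedTree.isGT T)

  succ : V G → V G
  succ v with v ≟ r
  ... | yes _   = r
  ... | no v≢r = proj₁ (outOne v v≢r)

  succ-root : succ r ≡ r
  succ-root with r ≟ r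
  ... | yes _  = refl
  ... | no r≢r = ⊥-elim (r≢r refl)

  arc-succ : ∀ {v} → v ≢ r → Arc G v (succ v)
  arc-succ {v} v≢r with v ≟ r
  ... | yes v≡r  = ⊥-elim (v≢r v≡r)
  ... | no v≢r′ = proj₁ (proj₂ (outOne v v≢r′))

  arc⇒succ : ∀ {v w} → v ≢ r → Arc G v w → w ≡ succ v
  arc⇒succ {v} {w} v≢r arc with v ≟ r
  ... | yes v≡r  = ⊥-elim (v≢r v≡r)
  ... | no v≢r′ = proj₂ (proj₂ (outOne v v≢r′)) w arc

  pathLength : ∀ {v} → Star (Arc G) v r → ∃[ k ] iterate succ v k ≡ r
  pathLength ε = 0 , refl
  pathLength {v} (arc ◅ path) with v ≟ r
  ... | yes v≡r = 0 , v≡r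
  ... | no v≢r with k , reach ← pathLength path =
    suc k , subst (λ w → iterate succ w k ≡ r) (arc⇒succ v≢r arc) reach

  open Depth _≟_ succ r (λ v → pathLength (reachRoot v))

  depth-succ< : ∀ {v} → v ≢ r → depth (succ v) < depth v
  depth-succ< v≢r = ℕP.≤-reflexive (sym (depth-step v≢r))

  depth-pred : ∀ {v n} → depth v ≡ suc n → v ≢ r × depth (succ v) ≡ n
  depth-pred {v} d = v≢r , ℕP.suc-injective (trans (sym (depth-step v≢r)) d)
    where
    v≢r : v ≢ r
    v≢r refl with () ← trans (sym depth-root) d

  descent : ℕ → V G → List (V G)
  descent zero    v = []
  descent (suc n) v = v ∷ descent n (succ v)

  descent-nonroot : ∀ {v} n → depth v ≡ n → All (r ≢_) (descent n v)
  descent-nonroot zero    _ = []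
  descent-nonroot (suc n) d = (proj₁ (depth-pred d) ∘ sym) ∷ descent-nonroot n (proj₂ (depth-pred d))

  descent-decreasing : ∀ {v} n → depth v ≡ n → Linked (λ x y → depth y < depth x) (descent n v)
  descent-decreasing zero          _ = []
  descent-decreasing (suc zero)    _ = [-]
  descent-decreasing (suc (suc n)) d =
    depth-succ< (proj₁ (depth-pred d)) ∷ descent-decreasing (suc n) (proj₂ (depth-pred d))

  descent-unique : ∀ {v} n → depth v ≡ n → Unique (descent n v)
  descent-unique n d = AllPairs.map (λ { lt refl → ℕP.<-irrefl refl lt })
    (Linked⇒AllPairs (λ p q → ℕP.<-trans q p) (descent-decreasing n d))

  descent-walk : ∀ {v} n → depth v ≡ n → Linked (Und G) (descent n v ++ r ∷ [])
  descent-walk     zero          _ = [-]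
  descent-walk {v} (suc zero)    d =
    (v≢r , inj₁ (subst (Arc G v) (depth≡0⇒root (proj₂ (depth-pred d))) (arc-succ v≢r))) ∷ [-]
    where
    v≢r : v ≢ r
    v≢r = proj₁ (depth-pred d)
  descent-walk {v} (suc (suc n)) d =
    (v≢succ , inj₁ (arc-succ v≢r)) ∷ descent-walk (suc n) (proj₂ (depth-pred d))
    where
    v≢r : v ≢ r
    v≢r = proj₁ (depth-pred d)

    v≢succ : v ≢ succ v
    v≢succ v≡succ = ℕP.<-irrefl (sym (cong depth v≡succ)) (depth-succ< v≢r)

  -- An arc r → v with v ≢ r would close the cycle r , v , succ v , … , r.
  root-arc : ∀ {v} → Arc G r v → v ≡ r
  root-arc {v} arc with v ≟ r
  ... | yes v≡r = v≡r
  ... | no v≢r with depth v in d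
  ...   | zero        = ⊥-elim (v≢r (depth≡0⇒root d))
  ...   | suc zero    = ⊥-elim (proj₁ acyclic r v (v≢r ∘ sym) arc
                          (subst (Arc G v) (depth≡0⇒root (proj₂ (depth-pred d))) (arc-succ v≢r)))
  ...   | suc (suc n) = ⊥-elim (proj₂ acyclic r v (succ v) (descent n (succ (succ v)))
                          (descent-nonroot _ d ∷ descent-unique _ d)
                          ((v≢r ∘ sym , inj₁ arc) ∷ descent-walk _ d))

  grounding : Grounding G r
  grounding = record
    { succ        = succ
    ; isGraphOf   = isGraphOf
    ; succ-root   = succ-root
    ; reachesRoot = λ v → pathLength (reachRoot v)
    }
    where
    isGraphOf : IsGraphOf G succ
    isGraphOf u v with u ≟ r
    ... | yes refl = mk⇔ root-arc (λ { refl → rootLoop })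
    ... | no u≢r   = mk⇔ (proj₂ (proj₂ (outOne u u≢r)) v) (λ { refl → proj₁ (proj₂ (outOne u u≢r)) })

groundingOf : (T : GroundedTree) → Grounding (graph T) (root T)
groundingOf = FromGroundedTree.grounding

finite-⊠ : ∀ {G H} → Finite G → Finite H → Finite (G ⊠ H)
finite-⊠ (m , φ) (n , ψ) = m * n , ↔-trans FinP.*↔× (φ ×-↔ ψ)

grounding-⊠ : ∀ {G H r s} → Grounding G r → Grounding H s → Grounding (G ⊠ H) (r , s)
grounding-⊠ {r = r} {s} 𝒢 ℋ = record
  { succ        = map 𝒢.succ ℋ.succ
  ; isGraphOf   = graphOf-⊠ 𝒢.isGraphOf ℋ.isGraphOf
  ; succ-root   = cong₂ _,_ 𝒢.succ-root ℋ.succ-root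
  ; reachesRoot = reaches
  }
  where
  module 𝒢 = Grounding 𝒢
  module ℋ = Grounding ℋ

  reaches : ∀ w → ∃[ k ] iterate (map 𝒢.succ ℋ.succ) w k ≡ (r , s)
  reaches (u , v) with 𝒢.reachesRoot u | ℋ.reachesRoot v
  ... | k , u↝r | l , v↝s = k + l , trans (iterate-map 𝒢.succ ℋ.succ u v (k + l))
    (cong₂ _,_ (iterate-stays 𝒢.succ 𝒢.succ-root u k u↝r l)
               (subst (λ n → iterate ℋ.succ v n ≡ s) (ℕP.+-comm l k) (iterate-stays ℋ.succ ℋ.succ-root v l v↝s k)))

isGroundedTree-⊠ : ∀ T₁ T₂ → IsGroundedTree (graph T₁ ⊠ graph T₂) (prodRoot T₁ T₂)
isGroundedTree-⊠ T₁ T₂ =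
  FromGrounding.isGroundedTree (prodDec T₁ T₂) (grounding-⊠ (groundingOf T₁) (groundingOf T₂))
    (finite-⊠ {graph T₁} {graph T₂} (IsGroundedTree.finite (isGT T₁)) (IsGroundedTree.finite (isGT T₂)))

-- Flowers

module _ {G : Graph} {r : V G} (_≟_ : DecidableEquality (V G)) (𝒢 : Grounding G r) where

  open Grounding 𝒢
  open Depth _≟_ succ r reachesRoot

  flowerStep : ∀ {α} → Fin α → (u : V G) → Dec (u ≡ r) → Fin α × V G
  flowerStep i u (yes _) = next i , r
  flowerStep i u (no _)  = i , succ u

  flowerSucc : ∀ {α} → Fin α × V G → Fin α × V G
  flowerSucc (i , u) = flowerStep i u (u ≟ r)

  graphOf-flower : ∀ α → IsGraphOf (flower α G r _≟_) flowerSucc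
  graphOf-flower α (i , u) (j , v) with u ≟ r
  ... | no _ rewrite ∧-identityʳ (E G u v) | ∨-identityʳ (does (i F.≟ j) ∧ E G u v) =
    graphOf-copies α isGraphOf (i , u) (j , v)
  ... | yes refl with v ≟ r
  ...   | yes refl rewrite ∧-zeroʳ (E G r r) | ∧-zeroʳ (does (i F.≟ j)) =
    ⇔-trans (T-does (j F.≟ next i)) (mk⇔ (cong (_, r)) (cong proj₁))
  ...   | no v≢r rewrite ∧-identityʳ (E G r v) | ∨-identityʳ (does (i F.≟ j) ∧ E G r v) =
    mk⇔ (λ arc → ⊥-elim (v≢r (trans (Equivalence.to (isGraphOf r v) (proj₂ (Equivalence.to T-∧ arc))) succ-root)))
        (λ e → ⊥-elim (v≢r (cong proj₂ e)))

  conj-cycle-flower : ∀ α → Conjugacy (map (next {α}) succ) flowerSucc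
  conj-cycle-flower α = record { bijection = φ ; commutes = commutes }
    where
    φ : (Fin α × V G) ↔ (Fin α × V G)
    φ = twist (λ u → rotate (depth u))

    commutes : ∀ x → Inverse.to φ (map next succ x) ≡ flowerSucc (Inverse.to φ x)
    commutes (i , u) with u ≟ r
    ... | yes refl rewrite succ-root | depth-root = refl
    ... | no u≢r   = cong (λ d → iterate next i d , succ u) (sym (depth-step u≢r))

  Cycle-⊠≅flower : ∀ α → (Cycle α ⊠ G) ≅ flower α G r _≟_
  Cycle-⊠≅flower α = graphOf-≅ (graphOf-⊠ (graphOf-Cycle α) isGraphOf) (graphOf-flower α) (conj-cycle-flower α)

-- Products of cycles

Fin-injective⇒surjective : ∀ {n} (h : Fin n → Fin n) → Injective _≡_ _≡_ h → ∀ y → ∃ λ x → h x ≡ y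
Fin-injective⇒surjective {suc n} h h-injective y with FinP.any? (λ x → h x F.≟ y)
... | yes hit  = hit
... | no  miss = ⊥-elim (ℕP.1+n≰n (FinP.injective⇒≤ punched-injective))
  where
  punched : Fin (suc n) → Fin n
  punched x = F.punchOut {i = y} {j = h x} (λ y≡hx → miss (x , sym y≡hx))

  punched-injective : Injective _≡_ _≡_ punched
  punched-injective eq = h-injective (FinP.punchOut-injective {i = y} _ _ eq)

injective⇒↔ : ∀ {A B : Set} {n} (f : A → B) → Injective _≡_ _≡_ f → A ↔ Fin n → B ↔ Fin n → A ↔ B
injective⇒↔ {A} {B} {n} f f-injective A↔ B↔ = mk↔ₛ′ f f⁻¹ f∘f⁻¹ (λ a → f-injective (f∘f⁻¹ (f a)))
  where
  module A↔ = Inverse A↔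
  module B↔ = Inverse B↔

  h : Fin n → Fin n
  h = B↔.to ∘ f ∘ A↔.from

  h-injective : Injective _≡_ _≡_ h
  h-injective eq = trans (sym (A↔.strictlyInverseˡ _))
    (trans (cong A↔.to (f-injective (Injection.injective (↔⇒↣ B↔) eq))) (A↔.strictlyInverseˡ _))

  f⁻¹ : B → A
  f⁻¹ b = A↔.from (proj₁ (Fin-injective⇒surjective h h-injective (B↔.to b)))

  f∘f⁻¹ : ∀ b → f (f⁻¹ b) ≡ b
  f∘f⁻¹ b = Injection.injective (↔⇒↣ B↔) (proj₂ (Fin-injective⇒surjective h h-injective (B↔.to b)))

[m+n]%o≡m⇒o∣n : ∀ m n o .{{_ : NonZero o}} → (m + n) % o ≡ m → o ∣ n
[m+n]%o≡m⇒o∣n m n o eq = divides ((m + n) / o) (ℕP.+-cancelˡ-≡ m n _ (begin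
  m + n                          ≡⟨ m≡m%n+[m/n]*n (m + n) o ⟩
  (m + n) % o + (m + n) / o * o  ≡⟨ cong (_+ (m + n) / o * o) eq ⟩
  m + (m + n) / o * o            ∎))
  where open ≡-Reasoning

[m+n]%o≡m′⇒m≡m′ : ∀ {m m′ n o d} .{{_ : NonZero o}} .{{_ : NonZero d}} → d ∣ o → d ∣ n →
                  m < d → m′ < d → (m + n) % o ≡ m′ → m ≡ m′
[m+n]%o≡m′⇒m≡m′ {m} {m′} {n} {o} {d} d∣o d∣n m<d m′<d eq = begin
  m                ≡⟨ m<n⇒m%n≡m m<d ⟨
  m % d            ≡⟨ %-remove-+ʳ m d∣n ⟨
  (m + n) % d      ≡⟨ m∣n⇒o%n%m≡o%m d o (m + n) d∣o ⟨
  (m + n) % o % d  ≡⟨ cong (_% d) eq ⟩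
  m′ % d           ≡⟨ m<n⇒m%n≡m m′<d ⟩
  m′               ∎
  where open ≡-Reasoning

n∣m∧m<n⇒m≡0 : ∀ {m n} → n ∣ m → m < n → m ≡ 0
n∣m∧m<n⇒m≡0 {zero}  _   _   = refl
n∣m∧m<n⇒m≡0 {suc m} n∣m m<n = ⊥-elim (>⇒∤ m<n n∣m)

module _ (a b : ℕ) where

  private
    α β γ l : ℕ
    α = suc a
    β = suc b
    γ = gcd α β
    l = lcm α β

    instance
      γ≢0 : NonZero γ
      γ≢0 = ≢-nonZero (gcd[m,n]≢0 α β (inj₁ λ ()))

      l≢0 : NonZero l
      l≢0 = m*n≢0⇒n≢0 γ {{subst NonZero (sym (gcd*lcm α β)) (m*n≢0 α β)}}

    γ≤α : γ ≤ α
    γ≤α = ∣⇒≤ (gcd[m,n]∣m α β)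

    embed : Fin γ × Fin l → Fin α × Fin β
    embed (c , k) = iterate next (inject≤ c γ≤α) (toℕ k) , iterate next zero (toℕ k)

    -- For m = k − k′: β ∣ m, hence γ ∣ m, which forces c = c′; then α ∣ m, so l ∣ m < l.
    embed-injective-≤ : ∀ {c c′ k k′} → toℕ k′ ≤ toℕ k → embed (c , k) ≡ embed (c′ , k′) → c ≡ c′ × k ≡ k′
    embed-injective-≤ {c} {c′} {k} {k′} k′≤k eq = c≡c′ , FinP.toℕ-injective k≡k′
      where
      m : ℕ
      m = toℕ k ∸ toℕ k′

      split : toℕ k ≡ m + toℕ k′
      split = sym (ℕP.m∸n+n≡m k′≤k)

      shiftα : iterate next (inject≤ c γ≤α) m ≡ inject≤ c′ γ≤α
      shiftα = iterate-next-cancel _ _ m (toℕ k′)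
        (subst (λ j → iterate next (inject≤ c γ≤α) j ≡ _) split (cong proj₁ eq))

      shiftβ : iterate next (zero {b}) m ≡ zero
      shiftβ = iterate-next-cancel _ _ m (toℕ k′)
        (subst (λ j → iterate next zero j ≡ _) split (cong proj₂ eq))

      β∣m : β ∣ m
      β∣m = [m+n]%o≡m⇒o∣n 0 m β (trans (sym (toℕ-iterate-next zero m)) (cong toℕ shiftβ))

      residue : (toℕ c + m) % α ≡ toℕ c′
      residue = begin
        (toℕ c + m) % α                    ≡⟨ cong (λ x → (x + m) % α) (FinP.toℕ-inject≤ c γ≤α) ⟨
        (toℕ (inject≤ c γ≤α) + m) % α      ≡⟨ toℕ-iterate-next (inject≤ c γ≤α) m ⟨
        toℕ (iterate next (inject≤ c γ≤α) m) ≡⟨ cong toℕ shiftα ⟩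
        toℕ (inject≤ c′ γ≤α)               ≡⟨ FinP.toℕ-inject≤ c′ γ≤α ⟩
        toℕ c′                             ∎
        where open ≡-Reasoning

      c≡c′ : c ≡ c′
      c≡c′ = FinP.toℕ-injective ([m+n]%o≡m′⇒m≡m′ (gcd[m,n]∣m α β) (∣-trans (gcd[m,n]∣n α β) β∣m)
                                   (FinP.toℕ<n c) (FinP.toℕ<n c′) residue)

      α∣m : α ∣ m
      α∣m = [m+n]%o≡m⇒o∣n (toℕ c) m α (trans residue (cong toℕ (sym c≡c′)))

      k≡k′ : toℕ k ≡ toℕ k′
      k≡k′ = trans split (cong (_+ toℕ k′)
        (n∣m∧m<n⇒m≡0 (lcm-least α∣m β∣m) (ℕP.≤-<-trans (ℕP.m∸n≤m (toℕ k) (toℕ k′)) (FinP.toℕ<n k))))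

    embed-injective : Injective _≡_ _≡_ embed
    embed-injective {c , k} {c′ , k′} eq with ℕP.≤-total (toℕ k′) (toℕ k)
    ... | inj₁ k′≤k = let c≡c′ , k≡k′ = embed-injective-≤ k′≤k eq in cong₂ _,_ c≡c′ k≡k′
    ... | inj₂ k≤k′ = let c′≡c , k′≡k = embed-injective-≤ k≤k′ (sym eq) in sym (cong₂ _,_ c′≡c k′≡k)

  conj-copies-cycles : Conjugacy (map₂ (next {l})) (map (next {α}) (next {β}))
  conj-copies-cycles = record
    { bijection = injective⇒↔ embed embed-injective (↔-sym FinP.*↔×)
                    (subst (λ n → (Fin α × Fin β) ↔ Fin n) (sym (gcd*lcm α β)) (↔-sym FinP.*↔×))
    ; commutes  = λ (c , k) → cong₂ _,_ (iterate-next-∣ (m∣lcm[m,n] α β) (inject≤ c γ≤α) k)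
                                         (iterate-next-∣ (n∣lcm[m,n] α β) zero k)
    }

-- Products of flowers

module _ {G H : Graph} {r s} (_≟ᴳ_ : DecidableEquality (V G)) (𝒢 : Grounding G r)
                             (_≟ᴴ_ : DecidableEquality (V H)) (ℋ : Grounding H s) where

  private
    _≟_ : DecidableEquality (V G × V H)
    _≟_ = ≡-dec _≟ᴳ_ _≟ᴴ_

    𝒢⊠ℋ : Grounding (G ⊠ H) (r , s)
    𝒢⊠ℋ = grounding-⊠ 𝒢 ℋ

    module 𝒢 = Grounding 𝒢
    module ℋ = Grounding ℋ

  flower-⊠≅flower : ∀ α → (flower α G r _≟ᴳ_ ⊠ H) ≅ flower α (G ⊠ H) (r , s) _≟_
  flower-⊠≅flower α =
    graphOf-≅ (graphOf-⊠ (graphOf-flower _≟ᴳ_ 𝒢 α) ℋ.isGraphOf) (graphOf-flower _≟_ 𝒢⊠ℋ α)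
      (conj-trans (conj-× (conj-sym (conj-cycle-flower _≟ᴳ_ 𝒢 α)) (conj-refl ℋ.succ))
      (conj-trans (conj-assoc next 𝒢.succ ℋ.succ)
                  (conj-cycle-flower _≟_ 𝒢⊠ℋ α)))

  flower-⊠-flower≅copies : ∀ a b → let α = suc a ; β = suc b in
    (flower α G r _≟ᴳ_ ⊠ flower β H s _≟ᴴ_) ≅ copies (gcd α β) (flower (lcm α β) (G ⊠ H) (r , s) _≟_)
  flower-⊠-flower≅copies a b =
    graphOf-≅ (graphOf-⊠ (graphOf-flower _≟ᴳ_ 𝒢 (suc a)) (graphOf-flower _≟ᴴ_ ℋ (suc b)))
              (graphOf-copies _ (graphOf-flower _≟_ 𝒢⊠ℋ _))
      (conj-trans (conj-× (conj-sym (conj-cycle-flower _≟ᴳ_ 𝒢 (suc a))) (conj-sym (conj-cycle-flower _≟ᴴ_ ℋ (suc b))))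
      (conj-trans (conj-interchange next 𝒢.succ next ℋ.succ)
      (conj-trans (conj-× (conj-sym (conj-copies-cycles a b)) (conj-refl (map 𝒢.succ ℋ.succ)))
      (conj-trans (conj-assoc id next (map 𝒢.succ ℋ.succ))
                  (conj-× (conj-refl id) (conj-cycle-flower _≟_ 𝒢⊠ℋ _))))))

-- The trees T_w^θ

shift : ∀ {n} → A → Vec A n → Vec A n
shift a []       = []
shift a (x ∷ xs) = xs ∷ʳ a

zip-∷ʳ : ∀ {n} (xs : Vec A n) (ys : Vec B n) a b → Vec.zip (xs ∷ʳ a) (ys ∷ʳ b) ≡ Vec.zip xs ys ∷ʳ (a , b)
zip-∷ʳ []       []       a b = refl
zip-∷ʳ (x ∷ xs) (y ∷ ys) a b = cong ((x , y) ∷_) (zip-∷ʳ xs ys a b)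

conj-shift-zip : ∀ {n} (a : A) (b : B) → Conjugacy (map (shift {n = n} a) (shift b)) (shift (a , b))
conj-shift-zip a b = record
  { bijection = ×v↔v×
  ; commutes  = λ { ([] , []) → refl ; (x ∷ xs , y ∷ ys) → zip-∷ʳ xs ys a b }
  }

conj-shift-map : ∀ {n} (e : A ↔ B) a → Conjugacy (shift {n = n} a) (shift (Inverse.to e a))
conj-shift-map e a = record
  { bijection = mk↔ₛ′ (Vec.map to) (Vec.map from) (map-inverse strictlyInverseˡ) (map-inverse strictlyInverseʳ)
  ; commutes  = λ { [] → refl ; (x ∷ xs) → map-∷ʳ to a xs }
  }
  where
  open Inverse e
  map-inverse : ∀ {C D : Set} {f : C → D} {g : D → C} {n} → (∀ x → f (g x) ≡ x) →
                ∀ (xs : Vec D n) → Vec.map f (Vec.map g xs) ≡ xs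
  map-inverse fg xs = trans (sym (map-∘ _ _ xs)) (trans (map-cong fg xs) (map-id xs))

module _ (w′ : ℕ) where

  private
    w : ℕ
    w = suc w′

  parentᴺ : Σ ℕ (Node w) → Σ ℕ (Node w)
  parentᴺ (zero  , x) = zero , x
  parentᴺ (suc j , x) = j , parent x

  nodeEq⇔≡ : ∀ {j} (x y : Node w j) → T (nodeEq x y) ⇔ x ≡ y
  nodeEq⇔≡ root′       root′       = mk⇔ (λ _ → refl) (λ _ → tt)
  nodeEq⇔≡ (top a)     (top b)     = ⇔-trans (T-does (a F.≟ b)) (mk⇔ (cong top) λ { refl → refl })
  nodeEq⇔≡ (child x n) (child y m) =
    ⇔-trans T-∧ (⇔-trans (T-does (x F.≟ y) ×-⇔ nodeEq⇔≡ n m) (mk⇔ (λ (p , q) → cong₂ child p q) λ { refl → refl , refl }))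

  tEdge⇔parent : ∀ j (x : Node w j) k (y : Node w k) → T (tEdge j x k y) ⇔ (k , y) ≡ parentᴺ (j , x)
  tEdge⇔parent zero    root′ zero    root′ = mk⇔ (λ _ → refl) (λ _ → tt)
  tEdge⇔parent zero    root′ (suc k) y     = mk⇔ (λ ()) (λ ())
  tEdge⇔parent (suc j) x     k       y with j ℕ.≟ k
  ... | yes refl = ⇔-trans (nodeEq⇔≡ (parent x) y) (mk⇔ (λ { refl → refl }) λ { refl → refl })
  ... | no j≢k   = mk⇔ (λ ()) (λ e → j≢k (sym (cong proj₁ e)))

  layered : ∀ {θ} → V (Tree w θ) → Σ ℕ (Node w)
  layered (j , x) = toℕ j , x

  layered-injective : ∀ {θ} {u v : V (Tree w θ)} → layered u ≡ layered v → u ≡ v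
  layered-injective {u = j , x} {k , y} eq with FinP.toℕ-injective {i = j} {j = k} (cong proj₁ eq)
  ... | refl with eq
  ...   | refl = refl

  -- A vertex child x₁ (child x₂ (… (top a))) of layer j is encoded by x₁ , x₂ , … , a + 1
  -- followed by θ − j zeros; the root by zeros only.
  digits : ∀ {θ} → V (Tree w θ) → Vec (Fin w) θ
  digits {θ}     (zero , root′)             = replicate θ zero
  digits {suc θ} (suc zero , top a)         = suc a ∷ replicate θ zero
  digits {suc θ} (suc (suc j) , child x n)  = x ∷ digits {θ} (suc j , n)

  push : ∀ {θ} → Fin w → V (Tree w θ) → V (Tree w (suc θ))
  push x       (suc j , n)    = suc (suc j) , child x n
  push zero    (zero , root′) = zero , root′
  push (suc a) (zero , root′) = suc zero , top a

  fromDigits : ∀ {θ} → Vec (Fin w) θ → V (Tree w θ)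
  fromDigits []      = zero , root′
  fromDigits (x ∷ v) = push x (fromDigits v)

  pushᴺ : Fin w → Σ ℕ (Node w) → Σ ℕ (Node w)
  pushᴺ x       (suc j , n)    = suc (suc j) , child x n
  pushᴺ zero    (zero , root′) = zero , root′
  pushᴺ (suc a) (zero , root′) = 1 , top a

  layered-push : ∀ {θ} x (u : V (Tree w θ)) → layered (push x u) ≡ pushᴺ x (layered u)
  layered-push x       (suc j , n)    = refl
  layered-push zero    (zero , root′) = refl
  layered-push (suc a) (zero , root′) = refl

  parentᴺ-pushᴺ : ∀ x t → parentᴺ (pushᴺ x t) ≡ t
  parentᴺ-pushᴺ x       (suc j , n)    = refl
  parentᴺ-pushᴺ zero    (zero , root′) = refl
  parentᴺ-pushᴺ (suc a) (zero , root′) = refl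

  fromDigits-replicate : ∀ θ → fromDigits (replicate θ zero) ≡ (zero , root′)
  fromDigits-replicate zero    = refl
  fromDigits-replicate (suc θ) rewrite fromDigits-replicate θ = refl

  fromDigits-digits : ∀ {θ} (u : V (Tree w θ)) → fromDigits (digits u) ≡ u
  fromDigits-digits {θ}     (zero , root′)            = fromDigits-replicate θ
  fromDigits-digits {suc θ} (suc zero , top a)        rewrite fromDigits-replicate θ = refl
  fromDigits-digits {suc θ} (suc (suc j) , child x n) rewrite fromDigits-digits {θ} (suc j , n) = refl

  digits-push : ∀ {θ} x (u : V (Tree w θ)) → digits (push x u) ≡ x ∷ digits u
  digits-push x       (suc j , n)    = refl
  digits-push zero    (zero , root′) = refl
  digits-push (suc a) (zero , root′) = refl

  digits-fromDigits : ∀ {θ} (v : Vec (Fin w) θ) → digits (fromDigits v) ≡ v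
  digits-fromDigits []      = refl
  digits-fromDigits (x ∷ v) = trans (digits-push x (fromDigits v)) (cong (x ∷_) (digits-fromDigits v))

  fromDigits-∷ʳ-zero : ∀ {θ} (v : Vec (Fin w) θ) → layered (fromDigits (v ∷ʳ zero)) ≡ layered (fromDigits v)
  fromDigits-∷ʳ-zero []      = refl
  fromDigits-∷ʳ-zero (x ∷ v) = begin
    layered (push x (fromDigits (v ∷ʳ zero)))  ≡⟨ layered-push x (fromDigits (v ∷ʳ zero)) ⟩
    pushᴺ x (layered (fromDigits (v ∷ʳ zero))) ≡⟨ cong (pushᴺ x) (fromDigits-∷ʳ-zero v) ⟩
    pushᴺ x (layered (fromDigits v))           ≡⟨ layered-push x (fromDigits v) ⟨
    layered (push x (fromDigits v))            ∎
    where open ≡-Reasoning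

  fromDigits-shift : ∀ {θ} (v : Vec (Fin w) θ) →
                     layered (fromDigits (shift zero v)) ≡ parentᴺ (layered (fromDigits v))
  fromDigits-shift []      = refl
  fromDigits-shift (x ∷ v) = begin
    layered (fromDigits (v ∷ʳ zero))            ≡⟨ fromDigits-∷ʳ-zero v ⟩
    layered (fromDigits v)                      ≡⟨ parentᴺ-pushᴺ x (layered (fromDigits v)) ⟨
    parentᴺ (pushᴺ x (layered (fromDigits v)))  ≡⟨ cong parentᴺ (layered-push x (fromDigits v)) ⟨
    parentᴺ (layered (push x (fromDigits v)))   ∎
    where open ≡-Reasoning

  -- Defined through the encoding, so that it is conjugate to shift by construction.
  treeParent : ∀ {θ} → V (Tree w θ) → V (Tree w θ)
  treeParent = fromDigits ∘ shift zero ∘ digits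

  layered-treeParent : ∀ {θ} (u : V (Tree w θ)) → layered (treeParent u) ≡ parentᴺ (layered u)
  layered-treeParent u = trans (fromDigits-shift (digits u)) (cong (parentᴺ ∘ layered) (fromDigits-digits u))

  graphOf-Tree : ∀ θ → IsGraphOf (Tree w θ) treeParent
  graphOf-Tree θ (j , x) (k , y) = ⇔-trans (tEdge⇔parent (toℕ j) x (toℕ k) y)
    (mk⇔ (λ e → layered-injective (trans e (sym (layered-treeParent (j , x)))))
         (λ { refl → layered-treeParent (j , x) }))

  conj-treeParent-shift : ∀ θ → Conjugacy (treeParent {θ}) (shift zero)
  conj-treeParent-shift θ = record
    { bijection = mk↔ₛ′ digits fromDigits digits-fromDigits fromDigits-digits
    ; commutes  = λ u → digits-fromDigits _
    }

Tree-⊠≅Tree : ∀ w₁ w₂ θ → (Tree (suc w₁) θ ⊠ Tree (suc w₂) θ) ≅ Tree (suc w₁ * suc w₂) θ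
Tree-⊠≅Tree w₁ w₂ θ =
  graphOf-≅ (graphOf-⊠ (graphOf-Tree w₁ θ) (graphOf-Tree w₂ θ)) (graphOf-Tree _ θ)
    (conj-trans (conj-× (conj-treeParent-shift w₁ θ) (conj-treeParent-shift w₂ θ))
    (conj-trans (conj-shift-zip zero zero)
    (conj-trans (conj-shift-map (↔-sym FinP.*↔×) (zero , zero))
                (conj-sym (conj-treeParent-shift _ θ)))))

-- In-degrees

inNeighbours-⊠ : ∀ G H v w → (Σ (V (G ⊠ H)) λ u → Arc (G ⊠ H) u (v , w))
                             ↔ ((Σ (V G) λ u → Arc G u v) × (Σ (V H) λ u → Arc H u w))
inNeighbours-⊠ G H v w = mk↔ₛ′
  (λ ((a , b) , arc) → let arcᴳ , arcᴴ = Equivalence.to T-∧ arc in (a , arcᴳ) , (b , arcᴴ))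
  (λ ((a , arcᴳ) , (b , arcᴴ)) → (a , b) , Equivalence.from T-∧ (arcᴳ , arcᴴ))
  (λ ((a , _) , (b , _)) → cong₂ (λ x y → (a , x) , (b , y)) (T-irrelevant _ _) (T-irrelevant _ _))
  (λ ((a , b) , _) → cong ((a , b) ,_) (T-irrelevant _ _))

inDegree-⊠ : ∀ G H {v w m n} → InDegree G v m → InDegree H w n → InDegree (G ⊠ H) (v , w) (m * n)
inDegree-⊠ G H {v} {w} {m} {n} dᴳ dᴴ = ↔-trans (inNeighbours-⊠ G H v w) (↔-trans (dᴳ ×-↔ dᴴ) (↔-sym (FinP.*↔× {m} {n})))

inDegree-⊠-or-0 : ∀ G H {v w m n} → InDegree G v m ⊎ InDegree G v 0 → InDegree H w n ⊎ InDegree H w 0 →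
                  InDegree (G ⊠ H) (v , w) (m * n) ⊎ InDegree (G ⊠ H) (v , w) 0
inDegree-⊠-or-0 G H         (inj₁ dᴳ) (inj₁ dᴴ) = inj₁ (inDegree-⊠ G H dᴳ dᴴ)
inDegree-⊠-or-0 G H {m = m} (inj₁ dᴳ) (inj₂ dᴴ) = inj₂ (subst (InDegree (G ⊠ H) _) (ℕP.*-zeroʳ m) (inDegree-⊠ G H dᴳ dᴴ))
inDegree-⊠-or-0 G H         (inj₂ dᴳ) (inj₁ dᴴ) = inj₂ (inDegree-⊠ G H dᴳ dᴴ)
inDegree-⊠-or-0 G H         (inj₂ dᴳ) (inj₂ dᴴ) = inj₂ (inDegree-⊠ G H dᴳ dᴴ)

mainTheorem13 :
  -- (1)
  (∀ (T₁ T₂ : GroundedTree) →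
     IsGroundedTree (graph T₁ ⊠ graph T₂) (prodRoot T₁ T₂))
  ×
  -- (2)
  (∀ (T₁ T₂ : GroundedTree) (w₁ w₂ : ℕ) →
     (∀ v → InDegree (graph T₁) v w₁ ⊎ InDegree (graph T₁) v 0) →
     (∀ v → InDegree (graph T₂) v w₂ ⊎ InDegree (graph T₂) v 0) →
     ∀ v → InDegree (graph T₁ ⊠ graph T₂) v (w₁ * w₂)
           ⊎ InDegree (graph T₁ ⊠ graph T₂) v 0)
  ×
  -- (3)
  (∀ (w₁ w₂ θ : ℕ) → 1 < w₁ → 1 < w₂ → 0 < θ →
     (Tree w₁ θ ⊠ Tree w₂ θ) ≅ Tree (w₁ * w₂) θ)
  ×
  -- (4)
  (∀ (T : GroundedTree) (α : ℕ) → 1 ≤ α →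
     (Cycle α ⊠ graph T) ≅ (C[ α ] T))
  ×
  -- (5)
  (∀ (T₁ T₂ : GroundedTree) (α : ℕ) → 1 ≤ α →
     ((C[ α ] T₁) ⊠ graph T₂)
       ≅ flower α (graph T₁ ⊠ graph T₂) (prodRoot T₁ T₂) (prodDec T₁ T₂))
  ×
  -- (6)
  (∀ (T₁ T₂ : GroundedTree) (α β : ℕ) → 1 ≤ α → 1 ≤ β →
     ((C[ α ] T₁) ⊠ (C[ β ] T₂))
       ≅ copies (gcd α β)
           (flower (lcm α β) (graph T₁ ⊠ graph T₂) (prodRoot T₁ T₂) (prodDec T₁ T₂)))
mainTheorem13 =
    isGroundedTree-⊠
  , (λ T₁ T₂ w₁ w₂ h₁ h₂ (v₁ , v₂) → inDegree-⊠-or-0 (graph T₁) (graph T₂) (h₁ v₁) (h₂ v₂))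
  , (λ { (suc w₁) (suc w₂) θ _ _ _ → Tree-⊠≅Tree w₁ w₂ θ })
  , (λ T α _ → Cycle-⊠≅flower (decEq T) (groundingOf T) α)
  , (λ T₁ T₂ α _ → flower-⊠≅flower (decEq T₁) (groundingOf T₁) (decEq T₂) (groundingOf T₂) α)
  , λ { T₁ T₂ (suc a) (suc b) _ _ → flower-⊠-flower≅copies (decEq T₁) (groundingOf T₁) (decEq T₂) (groundingOf T₂) a b }
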